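{- For $k\geq 2$, $\operatorname{zir}(\operatorname{Fr}(k))=\operatorname{Z}(\operatorname{Fr}(k))=\overline{\operatorname{Z}}(\operatorname{Fr}(k))=\operatorname{ZIR}(\operatorname{Fr}(k))=k+1$.
   Context: The $k$th friendship graph $\operatorname{Fr}(k)$ ($k\ge 2$) is the graph on $2k+1$ vertices obtained as the join of a single vertex with $k$ disjoint copies of $K_2$. Zero forcing: from a set $B$ of blue vertices, a blue vertex $u$ may turn a white vertex $w$ blue if $w$ is the only white neighbor of $u$; $B$ is a zero forcing set if eventually all vertices are blue. $\operatorname{Z}(G)$ is the minimum size of a zero forcing set; $\overline{\operatorname{Z}}(G)$ is the maximum size of an inclusion-minimal zero forcing set. A fort is a nonempty $F\subseteq V(G)$ such that every $v\notin F$ has $|F\cap N(v)|\neq 1$. For $S\subseteq V(G)$, $x\in S$, a private fort of $x$ relative to $S$ is a fort $F$ with $S\cap F=\{x\}$; $S$ is a ZIr-set if every element has a private fort. $\operatorname{zir}(G)$ and $\operatorname{ZIR}(G)$ are the minimum and maximum cardinality of an inclusion-maximal ZIr-set of $G$. -}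

module Defs where

open import Data.Nat using (ℕ; zero; suc; _+_; _≡ᵇ_; _/_; _≤_)
open import Data.Bool using (Bool; true; false; not; _∧_; T)
open import Data.Fin using (Fin; toℕ)
open import Data.Fin.Subset using (Subset; _∈_; _∉_; _⊆_; _∩_; _∪_; ⁅_⁆; ∣_∣; Nonempty)
open import Data.Vec using (tabulate)
open import Data.Product using (Σ; ∃; _×_; _,_)
open import Relation.Binary.PropositionalEquality using (_≡_; _≢_)

Graph : ℕ → Set
Graph n = Fin n → Fin n → Bool

N : ∀ {n} → Graph n → Fin n → Subset n
N G v = tabulate (G v)

Forces : ∀ {n} → Graph n → Subset n → Fin n → Fin n → Set
Forces G B u w =
  u ∈ B × w ∉ B × T (G u w) × (∀ x → T (G u x) → x ∉ B → x ≡ w)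

data Forcing {n} (G : Graph n) : Subset n → Set where
  done : ∀ {B} → (∀ v → v ∈ B) → Forcing G B
  step : ∀ {B} u w → Forces G B u w → Forcing G (B ∪ ⁅ w ⁆) → Forcing G B

IsZFS : ∀ {n} → Graph n → Subset n → Set
IsZFS G B = Forcing G B

IsMinimalZFS : ∀ {n} → Graph n → Subset n → Set
IsMinimalZFS G B = IsZFS G B × (∀ S → S ⊆ B → IsZFS G S → S ≡ B)

ZIs : ∀ {n} → Graph n → ℕ → Set
ZIs G m = (Σ _ λ B → IsZFS G B × ∣ B ∣ ≡ m) × (∀ B → IsZFS G B → m ≤ ∣ B ∣)

ZbarIs : ∀ {n} → Graph n → ℕ → Set
ZbarIs G m = (Σ _ λ B → IsMinimalZFS G B × ∣ B ∣ ≡ m)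
           × (∀ B → IsMinimalZFS G B → ∣ B ∣ ≤ m)

IsFort : ∀ {n} → Graph n → Subset n → Set
IsFort G F = Nonempty F × (∀ v → v ∉ F → ∣ F ∩ N G v ∣ ≢ 1)

PrivateFort : ∀ {n} → Graph n → Subset n → Fin n → Subset n → Set
PrivateFort G S x F = IsFort G F × S ∩ F ≡ ⁅ x ⁆

IsZIrSet : ∀ {n} → Graph n → Subset n → Set
IsZIrSet G S = ∀ x → x ∈ S → Σ _ λ F → PrivateFort G S x F

IsMaximalZIrSet : ∀ {n} → Graph n → Subset n → Set
IsMaximalZIrSet G S = IsZIrSet G S × (∀ T → S ⊆ T → IsZIrSet G T → T ≡ S)

zirIs : ∀ {n} → Graph n → ℕ → Set
zirIs G m = (Σ _ λ S → IsMaximalZIrSet G S × ∣ S ∣ ≡ m)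
          × (∀ S → IsMaximalZIrSet G S → m ≤ ∣ S ∣)

ZIRIs : ∀ {n} → Graph n → ℕ → Set
ZIRIs G m = (Σ _ λ S → IsMaximalZIrSet G S × ∣ S ∣ ≡ m)
          × (∀ S → IsMaximalZIrSet G S → ∣ S ∣ ≤ m)

-- Friendship graph Fr(k) on Fin (1 + (k + k)):
-- vertex 0 is the centre; vertices 2i+1, 2i+2 (i < k) form the i-th K₂.

frAdjℕ : ℕ → ℕ → Bool
frAdjℕ zero zero = false
frAdjℕ zero (suc _) = true
frAdjℕ (suc _) zero = true
frAdjℕ (suc a) (suc b) = not (a ≡ᵇ b) ∧ (a / 2 ≡ᵇ b / 2)

Fr : (k : ℕ) → Graph (suc (k + k))
Fr k u v = frAdjℕ (toℕ u) (toℕ v)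

-- Call the K₂'s of Fr(k) its blades.  Every blade is a fort, and so is every set containing the
-- centre and meeting every blade; since a zero forcing set meets every fort, a zero forcing set
-- meets every blade and contains the centre or a whole blade, and conversely such a set forces
-- first the centre and then each blade.  Call the centre, if it lies in S, and the blades
-- contained in S the excesses of S.  S is a ZIr-set exactly when it has at most one excess, the
-- private forts being blades or sets ⁅centre⁆ ∪ ⁅x⁆ ∪ ∁S.  Hence the minimal zero forcing sets
-- and the maximal ZIr-sets are both exactly the sets meeting every blade with exactly one
-- excess.  A set meeting every blade has k + (number of excesses) elements, so these sets have
-- k + 1 elements, and every zero forcing set has at least k + 1.
{-# OPTIONS --safe #-}
module Submission where

open import Defs
open import Data.Bool using (Bool; true; false; not; T)
open import Data.Bool.Properties using (not-¬; ¬-not; not-involutive; T-≡; T-∧)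
open import Data.Empty using (⊥; ⊥-elim)
open import Data.Fin using (Fin; zero; suc; toℕ; fromℕ<; _≟_)
open import Data.Fin.Properties using (toℕ-fromℕ<; toℕ-injective; toℕ<n; suc-injective; 0≢1+n; any?)
open import Data.Fin.Subset
  using (Subset; _∈_; _∉_; _⊆_; _⊂_; _∩_; _∪_; ∁; _-_; ⁅_⁆; ∣_∣; Nonempty; Empty)
  renaming (⊥ to ∅)
open import Data.Fin.Subset.Properties
open import Data.Maybe using (Maybe; nothing; just)
open import Data.Maybe.Properties using (just-injective; ≡-dec)
open import Data.Nat using (ℕ; zero; suc; _+_; _*_; _∸_; _≤_; _<_; _≡ᵇ_; _/_; _%_; z≤n; s≤s)
open import Data.Nat.DivMod
  using (m≡m%n+[m/n]*n; m%n<n; m<n*o⇒m/o<n; +-distrib-/-∣ʳ; m<n⇒m/n≡0; m*n/n≡m; [m+kn]%n≡m%n)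
open import Data.Nat.Divisibility using (n∣m*n)
open import Data.Nat.Induction using (<-wellFounded)
import Data.Nat.Properties as ℕ
open import Data.Product using (∃; ∃₂; _×_; _,_; proj₁; proj₂; map₂)
open import Data.Sum using (_⊎_; inj₁; inj₂; [_,_]′)
open import Data.Vec using (tabulate)
open import Data.Vec.Properties using (lookup∘tabulate; lookup⇒[]=; []=⇒lookup)
open import Function using (_∘_; _$_; id; Injective)
open import Function.Bundles using (Equivalence)
open import Induction.WellFounded using (Acc; acc)
open import Relation.Binary.PropositionalEquality
open import Relation.Nullary using (¬_; Dec; yes; no)

private
  variable
    n m : ℕ

-- Finite sets

∈-tabulate⁺ : (f : Fin n → Bool) {x : Fin n} → T (f x) → x ∈ tabulate f
∈-tabulate⁺ f {x} fx =
  lookup⇒[]= x (tabulate f) (trans (lookup∘tabulate f x) (Equivalence.to T-≡ fx))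

∈-tabulate⁻ : (f : Fin n → Bool) {x : Fin n} → x ∈ tabulate f → T (f x)
∈-tabulate⁻ f {x} x∈ = Equivalence.from T-≡ (trans (sym (lookup∘tabulate f x)) ([]=⇒lookup x∈))

injection⇒≤∣p∣ : {p : Subset n} (f : Fin m → Fin n) → Injective _≡_ _≡_ f → (∀ i → f i ∈ p) →
  m ≤ ∣ p ∣
injection⇒≤∣p∣ {m = zero}  f f-inj f∈p = z≤n
injection⇒≤∣p∣ {m = suc m} {p = p} f f-inj f∈p =
  ℕ.≤-trans (s≤s m≤∣p-f0∣) (x∈p⇒∣p-x∣<∣p∣ (f∈p zero))
  where
  m≤∣p-f0∣ : m ≤ ∣ p - f zero ∣
  m≤∣p-f0∣ = injection⇒≤∣p∣ (f ∘ suc) (suc-injective ∘ f-inj)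
    (λ i → x∈p∧x≢y⇒x∈p-y (f∈p (suc i)) (0≢1+n ∘ sym ∘ f-inj))

p≡⁅x⁆ : {p : Subset n} {x : Fin n} → x ∈ p → (∀ {y} → y ∈ p → y ≡ x) → p ≡ ⁅ x ⁆
p≡⁅x⁆ {x = x} x∈p unique = ⊆-antisym
  (λ y∈p → subst (_∈ ⁅ x ⁆) (sym (unique y∈p)) (x∈⁅x⁆ x))
  (λ y∈⁅x⁆ → subst (_∈ _) (sym (x∈⁅y⁆⇒x≡y x y∈⁅x⁆)) x∈p)

p∩q≡⁅x⁆ : {p q : Subset n} {x : Fin n} → x ∈ p → x ∈ q → (∀ {y} → y ∈ p → y ∈ q → y ≡ x) →
  p ∩ q ≡ ⁅ x ⁆
p∩q≡⁅x⁆ {p = p} {q} x∈p x∈q unique = p≡⁅x⁆ (x∈p∩q⁺ (x∈p , x∈q)) λ y∈ →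
  let y∈p , y∈q = x∈p∩q⁻ p q y∈ in unique y∈p y∈q

∣p∣≡1 : {p : Subset n} {x : Fin n} → x ∈ p → (∀ {y} → y ∈ p → y ≡ x) → ∣ p ∣ ≡ 1
∣p∣≡1 {x = x} x∈p unique = trans (cong ∣_∣ (p≡⁅x⁆ x∈p unique)) (∣⁅x⁆∣≡1 x)

two-elements⇒2≤∣p∣ : {p : Subset n} {x y : Fin n} → x ∈ p → y ∈ p → x ≢ y → 2 ≤ ∣ p ∣
two-elements⇒2≤∣p∣ x∈p y∈p x≢y = ℕ.≤-trans
  (s≤s (ℕ.≤-trans (s≤s z≤n) (x∈p⇒∣p-x∣<∣p∣ (x∈p∧x≢y⇒x∈p-y y∈p (x≢y ∘ sym)))))
  (x∈p⇒∣p-x∣<∣p∣ x∈p)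

m≤∣∁p∣⇒∣p∣+m≤n : (p : Subset n) → m ≤ ∣ ∁ p ∣ → ∣ p ∣ + m ≤ n
m≤∣∁p∣⇒∣p∣+m≤n {n} {m} p m≤∣∁p∣ = begin
  ∣ p ∣ + m            ≤⟨ ℕ.+-monoʳ-≤ ∣ p ∣ (subst (m ≤_) (∣∁p∣≡n∸∣p∣ p) m≤∣∁p∣) ⟩
  ∣ p ∣ + (n ∸ ∣ p ∣)  ≡⟨ ℕ.m+[n∸m]≡n (∣p∣≤n p) ⟩
  n                    ∎
  where open ℕ.≤-Reasoning

x∈p∪⁅y⁆∧x≢y⇒x∈p : {p : Subset n} {x y : Fin n} → x ∈ p ∪ ⁅ y ⁆ → x ≢ y → x ∈ p
x∈p∪⁅y⁆∧x≢y⇒x∈p {p = p} {y = y} x∈ x≢y with x∈p∪q⁻ p ⁅ y ⁆ x∈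
... | inj₁ x∈p   = x∈p
... | inj₂ x∈⁅y⁆ = ⊥-elim (x≢y (x∈⁅y⁆⇒x≡y y x∈⁅y⁆))

-- Forts and zero forcing in an arbitrary graph

module _ {G : Graph n} where

  ∈N⁺ : {u v : Fin n} → T (G u v) → v ∈ N G u
  ∈N⁺ {u} = ∈-tabulate⁺ (G u)

  ∈N⁻ : {u v : Fin n} → v ∈ N G u → T (G u v)
  ∈N⁻ {u} = ∈-tabulate⁻ (G u)

  two-neighbours⇒∣F∩N∣≢1 : {F : Subset n} (v : Fin n) {x y : Fin n} → x ∈ F → y ∈ F → x ≢ y →
    T (G v x) → T (G v y) → ∣ F ∩ N G v ∣ ≢ 1
  two-neighbours⇒∣F∩N∣≢1 v x∈F y∈F x≢y vx vy eq = ℕ.<-irrefl (sym eq)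
    (two-elements⇒2≤∣p∣ (x∈p∩q⁺ (x∈F , ∈N⁺ vx)) (x∈p∩q⁺ (y∈F , ∈N⁺ vy)) x≢y)

  no-neighbour⇒∣F∩N∣≢1 : {F : Subset n} (v : Fin n) → (∀ {y} → y ∈ F → ¬ T (G v y)) →
    ∣ F ∩ N G v ∣ ≢ 1
  no-neighbour⇒∣F∩N∣≢1 {F} v none eq = 0≢1 (begin
    0                ≡⟨ sym (∣⊥∣≡0 n) ⟩
    ∣ ∅ {n} ∣        ≡⟨ cong ∣_∣ (sym F∩N≡∅) ⟩
    ∣ F ∩ N G v ∣    ≡⟨ eq ⟩
    1                ∎)
    where
    open ≡-Reasoning
    0≢1 : 0 ≢ 1
    0≢1 ()
    F∩N≡∅ : F ∩ N G v ≡ ∅ {n}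
    F∩N≡∅ = Empty-unique λ (y , y∈) → let y∈F , y∈N = x∈p∩q⁻ F _ y∈ in none y∈F (∈N⁻ y∈N)

  fort⇒¬unique-neighbour : {F : Subset n} {v x : Fin n} → IsFort G F → v ∉ F → x ∈ F → T (G v x) →
    ¬ (∀ {y} → y ∈ F → T (G v y) → y ≡ x)
  fort⇒¬unique-neighbour {F} (_ , fort) v∉F x∈F vx unique =
    fort _ v∉F $ ∣p∣≡1 (x∈p∩q⁺ (x∈F , ∈N⁺ vx)) λ y∈ →
      let y∈F , y∈N = x∈p∩q⁻ F _ y∈ in unique y∈F (∈N⁻ y∈N)

  -- If u ∉ F, the fort condition gives u an F-neighbour other than w, and it is blue.
  forced-into-fort : {B F : Subset n} {u w : Fin n} → Forces G B u w → IsFort G F → w ∈ F →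
    Nonempty (B ∩ F)
  forced-into-fort {B} {F} {u} {w} (u∈B , _ , uw , white-unique) fort w∈F with u ∈? F
  ... | yes u∈F = u , x∈p∩q⁺ (u∈B , u∈F)
  ... | no  u∉F with nonempty? (B ∩ (F ∩ N G u))
  ...   | yes (y , y∈) =
          let y∈B , y∈F∩N = x∈p∩q⁻ B _ y∈ in y , x∈p∩q⁺ (y∈B , proj₁ (x∈p∩q⁻ F _ y∈F∩N))
  ...   | no  none = ⊥-elim $ fort⇒¬unique-neighbour fort u∉F w∈F uw λ {y} y∈F uy →
          white-unique y uy λ y∈B → none (y , x∈p∩q⁺ (y∈B , x∈p∩q⁺ (y∈F , ∈N⁺ uy)))

  zfs-meets-fort : {B F : Subset n} → IsZFS G B → IsFort G F → Nonempty (B ∩ F)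
  zfs-meets-fort (done all) ((x , x∈F) , _) = x , x∈p∩q⁺ (all x , x∈F)
  zfs-meets-fort {B} {F} (step u w forces forcing) fort with zfs-meets-fort forcing fort
  ... | x , x∈ with x∈p∩q⁻ (B ∪ ⁅ w ⁆) F x∈
  ...   | x∈B∪w , x∈F with x∈p∪q⁻ B ⁅ w ⁆ x∈B∪w
  ...     | inj₁ x∈B   = x , x∈p∩q⁺ (x∈B , x∈F)
  ...     | inj₂ x∈⁅w⁆ = forced-into-fort forces fort (subst (_∈ F) (x∈⁅y⁆⇒x≡y w x∈⁅w⁆) x∈F)

  zfs-by-progress : (P : Subset n → Set) →
    (∀ {B} → P B → (∀ v → v ∈ B) ⊎ ∃₂ λ u w → Forces G B u w × P (B ∪ ⁅ w ⁆)) →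
    ∀ {B} → P B → IsZFS G B
  zfs-by-progress P progress {B} = go B (<-wellFounded (n ∸ ∣ B ∣))
    where
    go : ∀ B → Acc _<_ (n ∸ ∣ B ∣) → P B → Forcing G B
    go B (acc rec) pB with progress pB
    ... | inj₁ all = done all
    ... | inj₂ (u , w , forces@(_ , w∉B , _) , pB∪w) = step u w forces (go _ (rec fewer-white) pB∪w)
      where
      B⊂B∪w : B ⊂ B ∪ ⁅ w ⁆
      B⊂B∪w = p⊆p∪q ⁅ w ⁆ , w , x∈p∪q⁺ (inj₂ (x∈⁅x⁆ w)) , w∉B
      fewer-white : n ∸ ∣ B ∪ ⁅ w ⁆ ∣ < n ∸ ∣ B ∣
      fewer-white = ℕ.∸-monoʳ-< (p⊂q⇒∣p∣<∣q∣ B⊂B∪w) (∣p∣≤n (B ∪ ⁅ w ⁆))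

minimal-zfs⇒¬zfs-removal : {G : Graph n} {B : Subset n} {x : Fin n} →
  IsMinimalZFS G B → x ∈ B → ¬ IsZFS G (B - x)
minimal-zfs⇒¬zfs-removal {B = B} {x} (_ , minimal) x∈B zfs =
  ℕ.<-irrefl (cong ∣_∣ (minimal (B - x) (p─q⊆p B ⁅ x ⁆) zfs)) (x∈p⇒∣p-x∣<∣p∣ x∈B)

maximal-zir⇒absorbs : {G : Graph n} {S : Subset n} {x : Fin n} →
  IsMaximalZIrSet G S → IsZIrSet G (S ∪ ⁅ x ⁆) → x ∈ S
maximal-zir⇒absorbs {S = S} {x} (_ , maximal) zir =
  subst (x ∈_) (maximal (S ∪ ⁅ x ⁆) (p⊆p∪q ⁅ x ⁆) zir) (x∈p∪q⁺ (inj₂ (x∈⁅x⁆ x)))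

-- Vertex numbering of Fr(k)

T-not⁺ : {x : Bool} → ¬ T x → T (not x)
T-not⁺ {false} _  = _
T-not⁺ {true}  ¬x = ¬x _

T-not⁻ : {x : Bool} → T (not x) → ¬ T x
T-not⁻ {false} _ ()

bit : Bool → ℕ
bit false = 0
bit true  = 1

bit<2 : ∀ b → bit b < 2
bit<2 false = s≤s z≤n
bit<2 true  = s≤s (s≤s z≤n)

bit-injective : ∀ {b b′} → bit b ≡ bit b′ → b ≡ b′
bit-injective {false} {false} _ = refl
bit-injective {true}  {true}  _ = refl

bit-surjective : ∀ {r} → r < 2 → ∃ λ b → r ≡ bit b
bit-surjective {zero}        _ = false , refl
bit-surjective {suc zero}    _ = true , refl
bit-surjective {suc (suc _)} (s≤s (s≤s ()))

-- Vertex 0 of Fr k is the centre, vertex 1 + leafIndex i b is the leaf b of the i-th K₂.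
leafIndex : ℕ → Bool → ℕ
leafIndex i b = bit b + i * 2

leafIndex/2 : ∀ i b → leafIndex i b / 2 ≡ i
leafIndex/2 i b = begin
  (bit b + i * 2) / 2    ≡⟨ +-distrib-/-∣ʳ (bit b) (n∣m*n i) ⟩
  bit b / 2 + i * 2 / 2  ≡⟨ cong₂ _+_ (m<n⇒m/n≡0 (bit<2 b)) (m*n/n≡m i 2) ⟩
  i                      ∎
  where open ≡-Reasoning

leafIndex-injective : ∀ {i j b b′} → leafIndex i b ≡ leafIndex j b′ → i ≡ j × b ≡ b′
leafIndex-injective {i} {j} {b} {b′} eq =
  i≡j , bit-injective (ℕ.+-cancelʳ-≡ (j * 2) (bit b) (bit b′) eq′)
  where
  i≡j : i ≡ j
  i≡j = trans (sym (leafIndex/2 i b)) (trans (cong (_/ 2) eq) (leafIndex/2 j b′))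
  eq′ : bit b + j * 2 ≡ bit b′ + j * 2
  eq′ = subst (λ i → bit b + i * 2 ≡ bit b′ + j * 2) i≡j eq

k*2≡k+k : ∀ k → k * 2 ≡ k + k
k*2≡k+k k = trans (ℕ.*-comm k 2) (cong (k +_) (ℕ.+-identityʳ k))

leafIndex< : ∀ {i k} b → i < k → leafIndex i b < k + k
leafIndex< {i} {k} b i<k = begin-strict
  bit b + i * 2  <⟨ ℕ.+-monoˡ-< (i * 2) (bit<2 b) ⟩
  suc i * 2      ≤⟨ ℕ.*-monoˡ-≤ 2 i<k ⟩
  k * 2          ≡⟨ k*2≡k+k k ⟩
  k + k          ∎
  where open ℕ.≤-Reasoning

leafIndex-surjective : ∀ {a k} → a < k + k → ∃₂ λ i b → i < k × a ≡ leafIndex i b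
leafIndex-surjective {a} {k} a<k+k with bit-surjective (m%n<n a 2)
... | b , a%2≡b = a / 2 , b , m<n*o⇒m/o<n (subst (a <_) (sym (k*2≡k+k k)) a<k+k)
                , trans (m≡m%n+[m/n]*n a 2) (cong (_+ a / 2 * 2) a%2≡b)

frAdjℕ-leaves⁻ : ∀ {i j b b′} → T (frAdjℕ (suc (leafIndex i b)) (suc (leafIndex j b′))) →
  i ≡ j × b ≢ b′
frAdjℕ-leaves⁻ {i} {j} {b} {b′} adj = i≡j , b≢b′
  where
  i≡j : i ≡ j
  i≡j = trans (sym (leafIndex/2 i b))
              (trans (ℕ.≡ᵇ⇒≡ _ _ (proj₂ (Equivalence.to T-∧ adj))) (leafIndex/2 j b′))
  b≢b′ : b ≢ b′
  b≢b′ b≡b′ = T-not⁻ (proj₁ (Equivalence.to T-∧ adj)) (ℕ.≡⇒≡ᵇ _ _ (cong₂ leafIndex i≡j b≡b′))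

frAdjℕ-leaves⁺ : ∀ {i b b′} → b ≢ b′ → T (frAdjℕ (suc (leafIndex i b)) (suc (leafIndex i b′)))
frAdjℕ-leaves⁺ {i} {b} {b′} b≢b′ = Equivalence.from T-∧
  ( T-not⁺ (b≢b′ ∘ proj₂ ∘ leafIndex-injective {i} {i} ∘ ℕ.≡ᵇ⇒≡ (leafIndex i b) (leafIndex i b′))
  , ℕ.≡⇒≡ᵇ _ _ (trans (leafIndex/2 i b) (sym (leafIndex/2 i b′))))

module FriendshipGraph (k : ℕ) where

  Vertex : Set
  Vertex = Fin (suc (k + k))

  centre : Vertex
  centre = zero

  -- Opaque so that unification can read i and b off a term leaf i b.
  opaque
    leaf : Fin k → Bool → Vertex
    leaf i b = suc (fromℕ< (leafIndex< b (toℕ<n i)))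

    toℕ-leaf : ∀ i b → toℕ (leaf i b) ≡ suc (leafIndex (toℕ i) b)
    toℕ-leaf i b = cong suc (toℕ-fromℕ< _)

  leaf≢centre : ∀ {i b} → leaf i b ≢ centre
  leaf≢centre {i} {b} eq = ℕ.0≢1+n (trans (cong toℕ (sym eq)) (toℕ-leaf i b))

  leaf-injective : ∀ {i j b b′} → leaf i b ≡ leaf j b′ → i ≡ j × b ≡ b′
  leaf-injective {i} {j} {b} {b′} eq with leafIndex-injective (ℕ.suc-injective toℕ-eq)
    where
    toℕ-eq : suc (leafIndex (toℕ i) b) ≡ suc (leafIndex (toℕ j) b′)
    toℕ-eq = trans (sym (toℕ-leaf i b)) (trans (cong toℕ eq) (toℕ-leaf j b′))
  ... | i≡j , b≡b′ = toℕ-injective i≡j , b≡b′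

  leaf≢partner : ∀ {i b} → leaf i b ≢ leaf i (not b)
  leaf≢partner = not-¬ refl ∘ proj₂ ∘ leaf-injective

  vertex-cases : ∀ v → v ≡ centre ⊎ ∃₂ λ i b → v ≡ leaf i b
  vertex-cases zero = inj₁ refl
  vertex-cases (suc a) with leafIndex-surjective (toℕ<n a)
  ... | i , b , i<k , a≡ = inj₂ (fromℕ< i<k , b , toℕ-injective (trans (cong suc a≡) (sym toℕ-eq)))
    where
    toℕ-eq : toℕ (leaf (fromℕ< i<k) b) ≡ suc (leafIndex i b)
    toℕ-eq = trans (toℕ-leaf (fromℕ< i<k) b) (cong (λ i → suc (leafIndex i b)) (toℕ-fromℕ< i<k))

  centre-adj-leaf : ∀ {i b} → T (Fr k centre (leaf i b))
  centre-adj-leaf {i} {b} = subst (T ∘ frAdjℕ 0) (sym (toℕ-leaf i b)) _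

  leaf-adj-centre : ∀ {i b} → T (Fr k (leaf i b) centre)
  leaf-adj-centre {i} {b} = subst (λ a → T (frAdjℕ a 0)) (sym (toℕ-leaf i b)) _

  leaf-adj-leaf : ∀ {i b b′} → b ≢ b′ → T (Fr k (leaf i b) (leaf i b′))
  leaf-adj-leaf {i} {b} {b′} b≢b′ =
    subst T (sym (cong₂ frAdjℕ (toℕ-leaf i b) (toℕ-leaf i b′))) (frAdjℕ-leaves⁺ {toℕ i} b≢b′)

  leaf-adj⇒ : ∀ {i b v} → T (Fr k (leaf i b) v) → v ≡ centre ⊎ v ≡ leaf i (not b)
  leaf-adj⇒ {i} {b} {v} adj with vertex-cases v
  ... | inj₁ v≡centre = inj₁ v≡centre
  ... | inj₂ (j , b′ , refl) with frAdjℕ-leaves⁻ {toℕ i} {toℕ j} {b} {b′}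
                                    (subst T (cong₂ frAdjℕ (toℕ-leaf i b) (toℕ-leaf j b′)) adj)
  ...   | i≡j , b≢b′ = inj₂ (cong₂ leaf (sym (toℕ-injective i≡j)) (¬-not (b≢b′ ∘ sym)))

  blade : Fin k → Subset (suc (k + k))
  blade i = ⁅ leaf i false ⁆ ∪ ⁅ leaf i true ⁆

  leaf∈blade : ∀ {i} b → leaf i b ∈ blade i
  leaf∈blade {i} false = x∈p∪q⁺ (inj₁ (x∈⁅x⁆ (leaf i false)))
  leaf∈blade {i} true  = x∈p∪q⁺ (inj₂ (x∈⁅x⁆ (leaf i true)))

  ∈blade⁻ : ∀ {i v} → v ∈ blade i → ∃ λ b → v ≡ leaf i b
  ∈blade⁻ {i} v∈ with x∈p∪q⁻ ⁅ leaf i false ⁆ ⁅ leaf i true ⁆ v∈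
  ... | inj₁ v∈⁅f⁆ = false , x∈⁅y⁆⇒x≡y _ v∈⁅f⁆
  ... | inj₂ v∈⁅t⁆ = true  , x∈⁅y⁆⇒x≡y _ v∈⁅t⁆

  Hits : Subset (suc (k + k)) → Fin k → Set
  Hits S i = ∃ λ b → leaf i b ∈ S

  Covers : Subset (suc (k + k)) → Fin k → Set
  Covers S i = ∀ b → leaf i b ∈ S

  covers : ∀ {S i b} → leaf i b ∈ S → leaf i (not b) ∈ S → Covers S i
  covers {b = false} b∈S _   false = b∈S
  covers {b = false} _   b̅∈S true  = b̅∈S
  covers {b = true}  _   b̅∈S false = b̅∈S
  covers {b = true}  b∈S _   true  = b∈S

  covers? : ∀ S i → Dec (Covers S i)
  covers? S i with leaf i false ∈? S | leaf i true ∈? S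
  ... | yes f∈S | yes t∈S = yes (covers f∈S t∈S)
  ... | no  f∉S | _       = no λ cov → f∉S (cov false)
  ... | _       | no  t∉S = no λ cov → t∉S (cov true)

  hits⇒partner∈ : ∀ {S i b} → Hits S i → leaf i b ∉ S → leaf i (not b) ∈ S
  hits⇒partner∈ {S} {i} {b} (b′ , b′∈S) b∉S with b′ Data.Bool.≟ b
  ... | yes refl = ⊥-elim (b∉S b′∈S)
  ... | no  b′≢b = subst (λ b′ → leaf i b′ ∈ S) (¬-not b′≢b) b′∈S

  ¬covers⇒hits∁ : ∀ {S i} → ¬ Covers S i → Hits (∁ S) i
  ¬covers⇒hits∁ {S} {i} ¬cov with leaf i false ∈? S
  ... | no  f∉S = false , x∉p⇒x∈∁p f∉S
  ... | yes f∈S = true  , x∉p⇒x∈∁p λ t∈S → ¬cov (covers f∈S t∈S)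

  centre∉fort⇒leaf∈fort : ∀ {F i b} → IsFort (Fr k) F → centre ∉ F → leaf i (not b) ∈ F →
    leaf i b ∈ F
  centre∉fort⇒leaf∈fort {F} {i} {b} fort c∉F b̅∈F with leaf i b ∈? F
  ... | yes b∈F = b∈F
  ... | no  b∉F = ⊥-elim $
        fort⇒¬unique-neighbour {G = Fr k} fort b∉F b̅∈F (leaf-adj-leaf (not-¬ refl)) λ y∈F adj →
          [ (λ y≡c → ⊥-elim (c∉F (subst (_∈ F) y≡c y∈F))) , id ]′ (leaf-adj⇒ adj)

  centre∈fort⇒hits : ∀ {F} → IsFort (Fr k) F → centre ∈ F → ∀ i → Hits F i
  centre∈fort⇒hits {F} fort c∈F i with leaf i false ∈? F | leaf i true ∈? F
  ... | yes f∈F | _       = false , f∈F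
  ... | _       | yes t∈F = true  , t∈F
  ... | no  f∉F | no  t∉F = ⊥-elim $
        fort⇒¬unique-neighbour {G = Fr k} fort f∉F c∈F leaf-adj-centre λ y∈F adj →
          [ id , (λ y≡t → ⊥-elim (t∉F (subst (_∈ F) y≡t y∈F))) ]′ (leaf-adj⇒ adj)

  centre∈F∧hits⇒fort : ∀ {F} → centre ∈ F → (∀ i → Hits F i) → IsFort (Fr k) F
  centre∈F∧hits⇒fort {F} c∈F hits = (centre , c∈F) , outside
    where
    outside : ∀ v → v ∉ F → ∣ F ∩ N (Fr k) v ∣ ≢ 1
    outside v v∉F with vertex-cases v
    ... | inj₁ refl           = ⊥-elim (v∉F c∈F)
    ... | inj₂ (i , b , refl) = two-neighbours⇒∣F∩N∣≢1 {G = Fr k} (leaf i b)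
            c∈F (hits⇒partner∈ (hits i) v∉F) (leaf≢centre ∘ sym)
            leaf-adj-centre (leaf-adj-leaf (not-¬ refl))

  blade-fort : ∀ i → IsFort (Fr k) (blade i)
  blade-fort i = (leaf i false , leaf∈blade false) , outside
    where
    outside : ∀ v → v ∉ blade i → ∣ blade i ∩ N (Fr k) v ∣ ≢ 1
    outside v v∉ with vertex-cases v
    ... | inj₁ refl = two-neighbours⇒∣F∩N∣≢1 {G = Fr k} centre
            (leaf∈blade false) (leaf∈blade true) leaf≢partner centre-adj-leaf centre-adj-leaf
    ... | inj₂ (j , b , refl) = no-neighbour⇒∣F∩N∣≢1 {G = Fr k} (leaf j b) λ y∈ adj →
            neighbour∉blade (∈blade⁻ y∈) (leaf-adj⇒ adj)
      where
      neighbour∉blade : ∀ {y} → (∃ λ b′ → y ≡ leaf i b′) → y ≡ centre ⊎ y ≡ leaf j (not b) → ⊥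
      neighbour∉blade (_  , refl) (inj₁ eq) = leaf≢centre eq
      neighbour∉blade (b′ , refl) (inj₂ eq) with leaf-injective eq
      ... | refl , _ = v∉ (leaf∈blade b)

  Excess : Subset (suc (k + k)) → Maybe (Fin k) → Set
  Excess S nothing  = centre ∈ S
  Excess S (just i) = Covers S i

  AtMostOneExcess : Subset (suc (k + k)) → Set
  AtMostOneExcess S = ∀ {i a} → Covers S i → Excess S a → a ≡ just i

  Forceable : Subset (suc (k + k)) → Set
  Forceable S = (∀ i → Hits S i) × ∃ (Excess S)

  Balanced : Subset (suc (k + k)) → Set
  Balanced S = Forceable S × AtMostOneExcess S

  nothing≢just : ∀ {i : Fin k} → nothing ≢ just i
  nothing≢just ()

  Excess-mono : ∀ {S T} → S ⊆ T → ∀ {a} → Excess S a → Excess T a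
  Excess-mono S⊆T {nothing} c∈S = S⊆T c∈S
  Excess-mono S⊆T {just i}  cov = S⊆T ∘ cov

  Forceable-mono : ∀ {S T} → S ⊆ T → Forceable S → Forceable T
  Forceable-mono S⊆T (hits , excess) = map₂ S⊆T ∘ hits , map₂ (Excess-mono S⊆T) excess

  Excess-∪-leaf : ∀ {S i b} → leaf i b ∉ S → leaf i (not b) ∉ S →
    ∀ {a} → Excess (S ∪ ⁅ leaf i b ⁆) a → Excess S a
  Excess-∪-leaf _ _ {nothing} c∈ = x∈p∪⁅y⁆∧x≢y⇒x∈p c∈ (leaf≢centre ∘ sym)
  Excess-∪-leaf {S} {i} {b} b∉S b̅∉S {just j} cov b′ =
    x∈p∪⁅y⁆∧x≢y⇒x∈p (cov b′) (j≢i ∘ proj₁ ∘ leaf-injective)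
    where
    j≢i : j ≢ i
    j≢i refl = b̅∉S (x∈p∪⁅y⁆∧x≢y⇒x∈p (cov (not b)) (leaf≢partner ∘ sym))

  Excess-remove-leaf : ∀ {S i b a} → Excess S a → a ≢ just i → Excess (S - leaf i b) a
  Excess-remove-leaf {a = nothing} c∈S _   = x∈p∧x≢y⇒x∈p-y c∈S (leaf≢centre ∘ sym)
  Excess-remove-leaf {a = just j}  cov a≢i = λ b′ →
    x∈p∧x≢y⇒x∈p-y (cov b′) (a≢i ∘ cong just ∘ proj₁ ∘ leaf-injective)

  leaf-forces-centre : ∀ {B j} → Covers B j → centre ∉ B → Forces (Fr k) B (leaf j false) centre
  leaf-forces-centre {B} cov c∉B = cov false , c∉B , leaf-adj-centre , λ x adj x∉B →
    [ id , (λ x≡t → ⊥-elim (x∉B (subst (_∈ B) (sym x≡t) (cov true)))) ]′ (leaf-adj⇒ adj)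

  leaf-forces-partner : ∀ {B i b} → centre ∈ B → leaf i (not b) ∈ B → leaf i b ∉ B →
    Forces (Fr k) B (leaf i (not b)) (leaf i b)
  leaf-forces-partner {B} {i} {b} c∈B b̅∈B b∉B =
    b̅∈B , b∉B , leaf-adj-leaf (not-¬ refl ∘ sym) , λ x adj x∉B →
      [ (λ x≡c → ⊥-elim (x∉B (subst (_∈ B) (sym x≡c) c∈B)))
      , (λ x≡b → trans x≡b (cong (leaf i) (not-involutive b))) ]′ (leaf-adj⇒ adj)

  zfs⇒hits : ∀ {B} → IsZFS (Fr k) B → ∀ i → Hits B i
  zfs⇒hits {B} zfs i with zfs-meets-fort zfs (blade-fort i)
  ... | y , y∈ with x∈p∩q⁻ B (blade i) y∈
  ...   | y∈B , y∈blade with ∈blade⁻ y∈blade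
  ...     | b , refl = b , y∈B

  zfs⇒excess : ∀ {B} → IsZFS (Fr k) B → ∃ (Excess B)
  zfs⇒excess {B} zfs with centre ∈? B
  ... | yes c∈B = nothing , c∈B
  ... | no  c∉B with any? (covers? B)
  ...   | yes (i , cov) = just i , cov
  ...   | no  none      = ⊥-elim (disjoint (zfs-meets-fort zfs (centre∈F∧hits⇒fort c∈F hits)))
    where
    F : Subset (suc (k + k))
    F = ⁅ centre ⁆ ∪ ∁ B
    c∈F : centre ∈ F
    c∈F = x∈p∪q⁺ (inj₁ (x∈⁅x⁆ centre))
    hits : ∀ i → Hits F i
    hits i = map₂ (x∈p∪q⁺ ∘ inj₂) (¬covers⇒hits∁ λ cov → none (i , cov))
    disjoint : Empty (B ∩ F)
    disjoint (y , y∈) with x∈p∩q⁻ B F y∈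
    ... | y∈B , y∈F with x∈p∪q⁻ ⁅ centre ⁆ (∁ B) y∈F
    ...   | inj₁ y∈⁅c⁆ = c∉B (subst (_∈ B) (x∈⁅y⁆⇒x≡y centre y∈⁅c⁆) y∈B)
    ...   | inj₂ y∈∁B  = x∈∁p⇒x∉p y∈∁B y∈B

  zfs⇒forceable : ∀ {B} → IsZFS (Fr k) B → Forceable B
  zfs⇒forceable zfs = zfs⇒hits zfs , zfs⇒excess zfs

  forceable⇒zfs : ∀ {B} → Forceable B → IsZFS (Fr k) B
  forceable⇒zfs = zfs-by-progress Forceable progress
    where
    progress : ∀ {B} → Forceable B →
      (∀ v → v ∈ B) ⊎ ∃₂ λ u w → Forces (Fr k) B u w × Forceable (B ∪ ⁅ w ⁆)
    progress {B} forceable with centre ∈? B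
    progress (_ , nothing , c∈B) | no c∉B = ⊥-elim (c∉B c∈B)
    progress forceable@(_ , just j , cov) | no c∉B =
      inj₂ (_ , _ , leaf-forces-centre cov c∉B , Forceable-mono (p⊆p∪q _) forceable)
    progress {B} forceable@(hits , _) | yes c∈B with nonempty? (∁ B)
    ... | no  none = inj₁ λ v → x∉∁p⇒x∈p λ v∈∁B → none (v , v∈∁B)
    ... | yes (w , w∈∁B) with vertex-cases w
    ...   | inj₁ refl           = ⊥-elim (x∈∁p⇒x∉p w∈∁B c∈B)
    ...   | inj₂ (i , b , refl) = inj₂ (_ , _ , forces , Forceable-mono (p⊆p∪q _) forceable)
      where
      b∉B : leaf i b ∉ B
      b∉B = x∈∁p⇒x∉p w∈∁B
      forces : Forces (Fr k) B (leaf i (not b)) (leaf i b)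
      forces = leaf-forces-partner c∈B (hits⇒partner∈ (hits i) b∉B) b∉B

  zir⇒atMostOneExcess : ∀ {S} → IsZIrSet (Fr k) S → AtMostOneExcess S
  zir⇒atMostOneExcess {S} zir {i} {a} cov excess with zir (leaf i false) (cov false)
  ... | F , fort , S∩F≡⁅x⁆ = only-blade-i a excess
    where
    x : Vertex
    x = leaf i false
    only-x : ∀ {y} → y ∈ S → y ∈ F → y ≡ x
    only-x y∈S y∈F = x∈⁅y⁆⇒x≡y x (subst (_ ∈_) S∩F≡⁅x⁆ (x∈p∩q⁺ (y∈S , y∈F)))
    x∈F : x ∈ F
    x∈F = proj₂ (x∈p∩q⁻ S F (subst (x ∈_) (sym S∩F≡⁅x⁆) (x∈⁅x⁆ x)))
    c∈F : centre ∈ F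
    c∈F with centre ∈? F
    ... | yes c∈F = c∈F
    ... | no  c∉F =
      ⊥-elim (leaf≢partner (sym (only-x (cov true) (centre∉fort⇒leaf∈fort fort c∉F x∈F))))
    only-blade-i : ∀ a → Excess S a → a ≡ just i
    only-blade-i nothing  c∈S = ⊥-elim (leaf≢centre (sym (only-x c∈S c∈F)))
    only-blade-i (just j) covj with centre∈fort⇒hits fort c∈F j
    ... | b , b∈F = cong just (proj₁ (leaf-injective (only-x (covj b) b∈F)))

  blade-privateFort : ∀ {S i b} → leaf i b ∈ S → leaf i (not b) ∉ S →
    PrivateFort (Fr k) S (leaf i b) (blade i)
  blade-privateFort {S} {i} {b} b∈S b̅∉S = blade-fort i , p∩q≡⁅x⁆ b∈S (leaf∈blade b) only
    where
    only : ∀ {y} → y ∈ S → y ∈ blade i → y ≡ leaf i b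
    only y∈S y∈blade with ∈blade⁻ y∈blade
    ... | b′ , refl with b′ Data.Bool.≟ b
    ...   | yes refl = refl
    ...   | no  b′≢b = ⊥-elim (b̅∉S (subst (λ b′ → leaf i b′ ∈ S) (¬-not b′≢b) y∈S))

  centre-privateFort : ∀ {S x} → x ∈ S → (centre ∈ S → x ≡ centre) →
    (∀ i → Covers S i → ∃ λ b → x ≡ leaf i b) → PrivateFort (Fr k) S x (⁅ centre ⁆ ∪ (⁅ x ⁆ ∪ ∁ S))
  centre-privateFort {S} {x} x∈S c∈S⇒x≡c cov⇒x∈blade =
    centre∈F∧hits⇒fort c∈F hits , p∩q≡⁅x⁆ x∈S x∈F only
    where
    F : Subset (suc (k + k))
    F = ⁅ centre ⁆ ∪ (⁅ x ⁆ ∪ ∁ S)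
    c∈F : centre ∈ F
    c∈F = x∈p∪q⁺ (inj₁ (x∈⁅x⁆ centre))
    x∈F : x ∈ F
    x∈F = x∈p∪q⁺ (inj₂ (x∈p∪q⁺ (inj₁ (x∈⁅x⁆ x))))
    hits : ∀ i → Hits F i
    hits i with covers? S i
    ... | yes cov = map₂ (λ x≡ → subst (_∈ F) x≡ x∈F) (cov⇒x∈blade i cov)
    ... | no ¬cov = map₂ (x∈p∪q⁺ ∘ inj₂ ∘ x∈p∪q⁺ ∘ inj₂) (¬covers⇒hits∁ ¬cov)
    only : ∀ {y} → y ∈ S → y ∈ F → y ≡ x
    only y∈S y∈F with x∈p∪q⁻ ⁅ centre ⁆ _ y∈F
    ... | inj₁ y∈⁅c⁆ = let y≡c = x∈⁅y⁆⇒x≡y centre y∈⁅c⁆ in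
                       trans y≡c (sym (c∈S⇒x≡c (subst (_∈ S) y≡c y∈S)))
    ... | inj₂ y∈ with x∈p∪q⁻ ⁅ x ⁆ (∁ S) y∈
    ...   | inj₁ y∈⁅x⁆ = x∈⁅y⁆⇒x≡y x y∈⁅x⁆
    ...   | inj₂ y∈∁S  = ⊥-elim (x∈∁p⇒x∉p y∈∁S y∈S)

  atMostOneExcess⇒zir : ∀ {S} → AtMostOneExcess S → IsZIrSet (Fr k) S
  atMostOneExcess⇒zir {S} unique x x∈S with vertex-cases x
  ... | inj₁ refl = _ , centre-privateFort x∈S (λ _ → refl) λ i cov →
                          ⊥-elim (nothing≢just (unique cov x∈S))
  ... | inj₂ (i , b , refl) with leaf i (not b) ∈? S
  ...   | no  b̅∉S = blade i , blade-privateFort x∈S b̅∉S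
  ...   | yes b̅∈S = _ , centre-privateFort x∈S (λ c∈S → ⊥-elim (nothing≢just (unique cov c∈S)))
                          λ j covj → b , cong (λ j → leaf j b) (just-injective (sym (unique cov covj)))
    where
    cov : Covers S i
    cov = covers x∈S b̅∈S

  transversal⇒k≤∣p∣ : ∀ {p} (f : Fin k → Bool) → (∀ i → leaf i (f i) ∈ p) → k ≤ ∣ p ∣
  transversal⇒k≤∣p∣ f = injection⇒≤∣p∣ (λ i → leaf i (f i)) (proj₁ ∘ leaf-injective)

  excess⇒outside-transversal : ∀ {S a} (f : Fin k → Bool) → Excess S a →
    ∃ λ x → x ∈ S × ∀ i → leaf i (f i) ≢ x
  excess⇒outside-transversal {a = nothing} f c∈S = centre , c∈S , λ _ → leaf≢centre
  excess⇒outside-transversal {a = just j}  f cov = leaf j (not (f j)) , cov (not (f j)) , λ i eq →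
    let i≡j , fi≡ = leaf-injective eq in not-¬ refl (trans (cong f (sym i≡j)) fi≡)

  forceable⇒k<∣S∣ : ∀ {S} → Forceable S → k < ∣ S ∣
  forceable⇒k<∣S∣ {S} (hits , _ , excess) with excess⇒outside-transversal (proj₁ ∘ hits) excess
  ... | x , x∈S , transversal≢x = ℕ.≤-<-trans
    (transversal⇒k≤∣p∣ _ λ i → x∈p∧x≢y⇒x∈p-y (proj₂ (hits i)) (transversal≢x i)) (x∈p⇒∣p-x∣<∣p∣ x∈S)

  atMostOneExcess⇒k≤∣∁S∣ : ∀ {S} → AtMostOneExcess S → k ≤ ∣ ∁ S ∣
  atMostOneExcess⇒k≤∣∁S∣ {S} unique with any? (covers? S)
  ... | no none = transversal⇒k≤∣p∣ (proj₁ ∘ uncovered) (proj₂ ∘ uncovered)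
    where
    uncovered : ∀ i → Hits (∁ S) i
    uncovered i = ¬covers⇒hits∁ λ cov → none (i , cov)
  ... | yes (j , covj) = injection⇒≤∣p∣ (λ i → pick i (i ≟ j))
                           (λ {i} {i′} → pick-injective (i ≟ j) (i′ ≟ j)) (λ i → pick∈∁S i (i ≟ j))
    where
    c∉S : centre ∉ S
    c∉S c∈S = nothing≢just (unique covj c∈S)
    uncovered : ∀ {i} → i ≢ j → Hits (∁ S) i
    uncovered i≢j = ¬covers⇒hits∁ λ covi → i≢j (just-injective (unique covj covi))
    -- The centre, which S misses, stands in for the covered blade j.
    pick : (i : Fin k) → Dec (i ≡ j) → Vertex
    pick i (yes _)   = centre
    pick i (no  i≢j) = leaf i (proj₁ (uncovered i≢j))
    pick∈∁S : ∀ i (d : Dec (i ≡ j)) → pick i d ∈ ∁ S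
    pick∈∁S i (yes _)   = x∉p⇒x∈∁p c∉S
    pick∈∁S i (no  i≢j) = proj₂ (uncovered i≢j)
    pick-injective : ∀ {i i′} (d : Dec (i ≡ j)) (d′ : Dec (i′ ≡ j)) → pick i d ≡ pick i′ d′ → i ≡ i′
    pick-injective (yes i≡j) (yes i′≡j) _  = trans i≡j (sym i′≡j)
    pick-injective (yes _)   (no  _)    eq = ⊥-elim (leaf≢centre (sym eq))
    pick-injective (no  _)   (yes _)    eq = ⊥-elim (leaf≢centre eq)
    pick-injective (no  _)   (no  _)    eq = proj₁ (leaf-injective eq)

  balanced⇒∣S∣≡1+k : ∀ {S} → Balanced S → ∣ S ∣ ≡ suc k
  balanced⇒∣S∣≡1+k {S} (forceable , unique) = ℕ.≤-antisym
    (ℕ.+-cancelʳ-≤ k ∣ S ∣ (suc k) (m≤∣∁p∣⇒∣p∣+m≤n S (atMostOneExcess⇒k≤∣∁S∣ unique)))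
    (forceable⇒k<∣S∣ forceable)

  maximal-zir⇒balanced : ∀ {S} → IsMaximalZIrSet (Fr k) S → Balanced S
  maximal-zir⇒balanced {S} maximal = (hits , excess) , unique
    where
    unique : AtMostOneExcess S
    unique = zir⇒atMostOneExcess (proj₁ maximal)
    absorbs : ∀ {x} → AtMostOneExcess (S ∪ ⁅ x ⁆) → x ∈ S
    absorbs = maximal-zir⇒absorbs {G = Fr k} maximal ∘ atMostOneExcess⇒zir
    hits : ∀ i → Hits S i
    hits i with leaf i false ∈? S | leaf i true ∈? S
    ... | yes f∈S | _       = false , f∈S
    ... | _       | yes t∈S = true  , t∈S
    ... | no  f∉S | no  t∉S = ⊥-elim (f∉S (absorbs λ cov excess →
            unique (Excess-∪-leaf f∉S t∉S {just _} cov) (Excess-∪-leaf f∉S t∉S excess)))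
    excess : ∃ (Excess S)
    excess with centre ∈? S
    ... | yes c∈S = nothing , c∈S
    ... | no  c∉S with any? (covers? S)
    ...   | yes (j , cov) = just j , cov
    ...   | no  none      = ⊥-elim (c∉S (absorbs λ {i} cov _ →
            ⊥-elim (none (i , λ b → x∈p∪⁅y⁆∧x≢y⇒x∈p (cov b) leaf≢centre))))

  minimal-zfs⇒balanced : ∀ {B} → IsMinimalZFS (Fr k) B → Balanced B
  minimal-zfs⇒balanced {B} minimal = forceable , unique
    where
    forceable : Forceable B
    forceable = zfs⇒forceable (proj₁ minimal)
    unique : AtMostOneExcess B
    unique {i} {a} cov excess with ≡-dec _≟_ a (just i)
    ... | yes a≡i = a≡i
    ... | no  a≢i = ⊥-elim (minimal-zfs⇒¬zfs-removal {G = Fr k} minimal (cov true)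
                     (forceable⇒zfs (hits′ , a , Excess-remove-leaf excess a≢i)))
      where
      hits′ : ∀ j → Hits (B - leaf i true) j
      hits′ j with j ≟ i
      ... | yes refl = false , x∈p∧x≢y⇒x∈p-y (cov false) leaf≢partner
      ... | no  j≢i  =
        map₂ (λ b∈B → x∈p∧x≢y⇒x∈p-y b∈B (j≢i ∘ proj₁ ∘ leaf-injective)) (proj₁ forceable j)

  -- A vertex of T outside S would give T a second excess besides the one inherited from S.
  forceable∧⊆∧atMostOneExcess⇒≡ : ∀ {S T} → S ⊆ T → Forceable S → AtMostOneExcess T → S ≡ T
  forceable∧⊆∧atMostOneExcess⇒≡ {S} {T} S⊆T (hits , a , excess) uniqueT = ⊆-antisym S⊆T T⊆S
    where
    T⊆S : T ⊆ S
    T⊆S {y} y∈T with y ∈? S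
    ... | yes y∈S = y∈S
    ... | no  y∉S with vertex-cases y
    ...   | inj₁ refl = ⊥-elim (excess-of-S a excess)
      where
      excess-of-S : ∀ a → Excess S a → ⊥
      excess-of-S nothing  c∈S = y∉S c∈S
      excess-of-S (just j) cov = nothing≢just (uniqueT (S⊆T ∘ cov) y∈T)
    ...   | inj₂ (i , b , refl) = subst (Excess S) (uniqueT covT (Excess-mono S⊆T excess)) excess b
      where
      covT : Covers T i
      covT = covers y∈T (S⊆T (hits⇒partner∈ (hits i) y∉S))

  balanced⇒maximal-zir : ∀ {S} → Balanced S → IsMaximalZIrSet (Fr k) S
  balanced⇒maximal-zir (forceable , unique) = atMostOneExcess⇒zir unique , λ T S⊆T zirT →
    sym (forceable∧⊆∧atMostOneExcess⇒≡ S⊆T forceable (zir⇒atMostOneExcess zirT))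

  balanced⇒minimal-zfs : ∀ {B} → Balanced B → IsMinimalZFS (Fr k) B
  balanced⇒minimal-zfs (forceable , unique) = forceable⇒zfs forceable , λ S S⊆B zfsS →
    forceable∧⊆∧atMostOneExcess⇒≡ S⊆B (zfs⇒forceable zfsS) unique

  evenIndex : Vertex → Bool
  evenIndex v = toℕ v % 2 ≡ᵇ 0

  -- The centre together with the leaf `true` of every blade.
  evenVertices : Subset (suc (k + k))
  evenVertices = tabulate evenIndex

  toℕ-leaf%2 : ∀ i b → toℕ (leaf i b) % 2 ≡ suc (bit b) % 2
  toℕ-leaf%2 i b = trans (cong (_% 2) (toℕ-leaf i b)) ([m+kn]%n≡m%n (suc (bit b)) (toℕ i) 2)

  evenVertices-balanced : Balanced evenVertices
  evenVertices-balanced =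
    ((λ i → true , true∈) , nothing , ∈-tabulate⁺ evenIndex _) , λ cov _ → ⊥-elim (false∉ (cov false))
    where
    true∈ : ∀ {i} → leaf i true ∈ evenVertices
    true∈ {i} = ∈-tabulate⁺ evenIndex (subst (λ r → T (r ≡ᵇ 0)) (sym (toℕ-leaf%2 i true)) _)
    false∉ : ∀ {i} → leaf i false ∉ evenVertices
    false∉ {i} false∈ = subst (λ r → T (r ≡ᵇ 0)) (toℕ-leaf%2 i false) (∈-tabulate⁻ evenIndex false∈)

proposition3p5 : (k : ℕ) → 2 ≤ k →
    zirIs (Fr k) (suc k) × ZIs (Fr k) (suc k) × ZbarIs (Fr k) (suc k) × ZIRIs (Fr k) (suc k)
proposition3p5 k _ =
    ((W , maximal-W , ∣W∣) , λ _ → ℕ.≤-reflexive ∘ sym ∘ size ∘ maximal-zir⇒balanced)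
  , ((W , proj₁ minimal-W , ∣W∣) , λ _ → forceable⇒k<∣S∣ ∘ zfs⇒forceable)
  , ((W , minimal-W , ∣W∣) , λ _ → ℕ.≤-reflexive ∘ size ∘ minimal-zfs⇒balanced)
  , ((W , maximal-W , ∣W∣) , λ _ → ℕ.≤-reflexive ∘ size ∘ maximal-zir⇒balanced)
  where
  open FriendshipGraph k
  size : ∀ {S} → Balanced S → ∣ S ∣ ≡ suc k
  size = balanced⇒∣S∣≡1+k
  W : Subset (suc (k + k))
  W = evenVertices
  ∣W∣ : ∣ W ∣ ≡ suc k
  ∣W∣ = size evenVertices-balanced
  maximal-W : IsMaximalZIrSet (Fr k) W
  maximal-W = balanced⇒maximal-zir evenVertices-balanced
  minimal-W : IsMinimalZFS (Fr k) W
  minimal-W = balanced⇒minimal-zfs evenVertices-balanced
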